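{- Let $Q$ be finite with rank function $\rho$ and maximal rank $m$, with types, models and type interpretation as in the context. For every $k\le m$, every simple type $A$ and every $d\in\mathcal{D}^k_A$, there is $S\subseteq\mathcal{T}^k_A$ with $[\![S]\!]^k=d$, and there is $S'\subseteq\tau^k_A$ with $[\![S']\!]^k=\overline{d}$.
   Context: $Q_k=\{q:\rho(q)=k\}$, $Q_{\le k}=\{q:\rho(q)\le k\}$. Intersection types: $\tau^k_o=Q_k$, $\tau^k_{A\to B}=\{T\to s: T\subseteq\mathcal{T}^k_A, s\in\tau^k_B\}$, $\mathcal{T}^k_A=\bigcup_{l\le k}\tau^l_A$. Models: $\mathcal{D}^0_o=\mathcal{P}(Q_0)$, $\mathcal{D}^0_{A\to B}$ = monotone maps; for $k>0$: $\mathcal{D}^k_o=\mathcal{P}(Q_{\le k})$, $\mathcal{L}^k_o=\{(R,P): R=P\cap Q_{\le k-1}\}$, $\mathcal{L}^k_{A\to B}=\{(f_1,f_2): f_1\in\mathcal{D}^{k-1}_{A\to B}$, $f_2$ monotone $\mathcal{D}^k_A\to\mathcal{D}^k_B$, $(f_1(g_1),f_2(g_2))\in\mathcal{L}^k_B$ whenever $(g_1,g_2)\in\mathcal{L}^k_A\}$, $\mathcal{D}^k_{A\to B}=\{f_2:\exists f_1,(f_1,f_2)\in\mathcal{L}^k_{A\to B}\}$; order inclusion/pointwise; $\bot^k_B$ least element. Step function: $(d\Rightarrow e)(h)=e$ if $d\le h$, else $\bot^k_B$. $[\![q]\!]^k=\{q\}$ if $\rho(q)\le k$, else $\emptyset$;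 $[\![S]\!]^k=\bigvee\{[\![t]\!]^k:t\in S\}$; $[\![T\to s]\!]^k=[\![T]\!]^k\Rightarrow[\![s]\!]^k$. The operation $\overline{\cdot}$: $\overline{d}=d\cap Q_k$ for $d\in\mathcal{D}^k_o$, and $\overline{d}(e)=\overline{d(e)}$ at arrow types. -}

module Defs where

open import Data.Nat using (ℕ; zero; suc; _≤_; _≤ᵇ_; _≡ᵇ_)
open import Data.Fin using (Fin)
open import Data.Fin.Subset using (Subset; _⊆_; _∩_; _∪_; ⁅_⁆) renaming (⊥ to ∅)
open import Data.Vec using (tabulate)
open import Data.List using (List; []; _∷_)
open import Data.Bool using (if_then_else_)
open import Data.Product using (Σ; _×_; ∃)
open import Relation.Nullary using (¬_)
open import Data.Unit using (⊤)
open import Relation.Binary.PropositionalEquality using (_≡_)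

data Ty : Set where
  o   : Ty
  _⇒_ : Ty → Ty → Ty

infixr 5 _⇒_

module Model (n : ℕ) (ρ : Fin n → ℕ) where

  Q≤ : ℕ → Subset n
  Q≤ k = tabulate (λ q → ρ q ≤ᵇ k)

  Q= : ℕ → Subset n
  Q= k = tabulate (λ q → ρ q ≡ᵇ k)

  Raw : Ty → Set
  Raw o       = Subset n
  Raw (A ⇒ B) = Raw A → Raw B

  bot : ∀ A → Raw A
  bot o       = ∅
  bot (A ⇒ B) = λ _ → bot B

  join : ∀ A → Raw A → Raw A → Raw A
  join o       P R = P ∪ R
  join (A ⇒ B) f g = λ x → join B (f x) (g x)

  over : ℕ → ∀ A → Raw A → Raw A
  over k o       d = d ∩ Q= k
  over k (A ⇒ B) f = λ e → over k B (f e)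

  mutual
    Le : ℕ → ∀ A → Raw A → Raw A → Set
    Le k o       P R = P ⊆ R
    Le k (A ⇒ B) f g = ∀ x → D k A x → Le k B (f x) (g x)

    D : ℕ → ∀ A → Raw A → Set
    D k       o       P  = P ⊆ Q≤ k
    D zero    (A ⇒ B) f  =
      (∀ x → D zero A x → D zero B (f x)) ×
      (∀ x y → D zero A x → D zero A y → Le zero A x y → Le zero B (f x) (f y))
    D (suc k) (A ⇒ B) f₂ = Σ (Raw (A ⇒ B)) λ f₁ → L k (A ⇒ B) f₁ f₂

    -- L k A g₁ g₂  means  (g₁ , g₂) ∈ L^{k+1}_A
    L : ℕ → ∀ A → Raw A → Raw A → Set
    L k o       R P   = D k o R × D (suc k) o P × R ≡ P ∩ Q≤ k
    L k (A ⇒ B) f₁ f₂ =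
      D k (A ⇒ B) f₁ ×
      ((∀ x → D (suc k) A x → D (suc k) B (f₂ x)) ×
       (∀ x y → D (suc k) A x → D (suc k) A y → Le (suc k) A x y → Le (suc k) B (f₂ x) (f₂ y))) ×
      (∀ g₁ g₂ → L k A g₁ g₂ → L k B (f₁ g₁) (f₂ g₂))

  Eq : ℕ → ∀ A → Raw A → Raw A → Set
  Eq k A x y = Le k A x y × Le k A y x

  -- intersection types (sets of types represented by finite lists)
  data IT : Ty → Set where
    base : Fin n → IT o
    arr  : ∀ {A B} → List (IT A) → IT B → IT (A ⇒ B)

  mutual
    InTau : ℕ → ∀ {A} → IT A → Set
    InTau k (base q)  = ρ q ≡ k
    InTau k (arr T s) = AllInT k T × InTau k s

    InT : ℕ → ∀ {A} → IT A → Set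
    InT k t = ∃ λ l → l ≤ k × InTau l t

    AllInT : ℕ → ∀ {A} → List (IT A) → Set
    AllInT k []      = ⊤
    AllInT k (t ∷ T) = InT k t × AllInT k T

  AllInTau : ℕ → ∀ {A} → List (IT A) → Set
  AllInTau k []      = ⊤
  AllInTau k (t ∷ T) = InTau k t × AllInTau k T

  sing : ℕ → Fin n → Subset n
  sing k q = if ρ q ≤ᵇ k then ⁅ q ⁆ else ∅

  Step : ℕ → ∀ A B → Raw A → Raw B → Raw (A ⇒ B) → Set
  Step k A B d e f = ∀ h → D k A h →
    (Le k A d h → Eq k B (f h) e) × (¬ Le k A d h → Eq k B (f h) (bot B))

  mutual
    Den : ℕ → ∀ {A} → IT A → Raw A → Set
    Den k (base q) d = Eq k o d (sing k q)
    Den k {A ⇒ B} (arr T s) f =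
      Σ (Raw A) λ dT → Σ (Raw B) λ ds → DenS k T dT × Den k s ds × Step k A B dT ds f

    DenS : ℕ → ∀ {A} → List (IT A) → Raw A → Set
    DenS k {A} []      d = Eq k A d (bot A)
    DenS k {A} (t ∷ S) d =
      Σ (Raw A) λ e₁ → Σ (Raw A) λ e₂ → Den k t e₁ × DenS k S e₂ × Eq k A d (join A e₁ e₂)

-- At level k the type U → u denotes the step function ⟦U⟧ ⇒ ⟦u⟧, and for h ∈ Dᵏ the test
-- ⟦U → u⟧ ≤ h reduces to ⟦u⟧ ≤ h ⟦U⟧, so it is decidable. As Q is finite, the types of each rank
-- can be enumerated, arguments ranging over sublists of the enumeration of 𝒯ᵏ_A. Then d̄ is the
-- join of the enumerated types of τᵏ_A lying below d: at an arrow type every h ∈ Dᵏ_A equals ⟦T⟧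
-- for such a sublist T (by the first claim at the smaller type A), so d̄(h) = d̄(⟦T⟧) is generated
-- by the types T → s with s generating d̄(⟦T⟧). At level 0 we have d = d̄. At level k+1, d agrees
-- below rank k with its partner d₁ ∈ Dᵏ, which is ⟦S₁⟧ by induction on k, and above rank k it is
-- d̄; so S₁ together with the generators of d̄ represents d.

module Submission where

open import Defs
open import Data.Bool using (Bool; true; false; T; _∧_; if_then_else_)
open import Data.Bool.Properties using (T-∧; T-≡; T?; ∧-identityʳ)
open import Data.Empty using (⊥-elim)
open import Data.Fin using (Fin)
open import Data.Fin.Subset using (Subset; _⊆_; _∩_; _∪_; ⁅_⁆; _∈_) renaming (⊥ to ∅)
open import Data.Fin.Subset.Properties
  using (x∈⁅x⁆; x∈⁅y⁆⇒x≡y; ∉⊥; ⊆-antisym; p∩q⊆p; p∩q⊆q; x∈p∩q⁺; x∈p∩q⁻; x∈p∪q⁻; x∈p∪q⁺; p⊆p∪q; q⊆p∪q; ∩-distribʳ-∪)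
open import Data.List using (List; []; _∷_; _++_; map; concatMap; filter; filterᵇ; allFin)
open import Data.List.Membership.Propositional using (find; lose) renaming (_∈_ to _∈ˡ_)
open import Data.List.Membership.Propositional.Properties
  using (∈-map⁺; ∈-map⁻; ∈-++⁺ˡ; ∈-++⁺ʳ; ∈-++⁻; ∈-allFin; ∈-filter⁺; ∈-filter⁻; ∈-concatMap⁺; ∈-concatMap⁻)
open import Data.List.Relation.Binary.Subset.Propositional using () renaming (_⊆_ to _⊆ˡ_)
open import Data.List.Relation.Binary.Subset.Propositional.Properties using (∈-∷⁺ʳ; ++⁺)
open import Data.List.Relation.Unary.Any using (here; there)
open import Data.Nat using (ℕ; zero; suc; _≤_; _≤ᵇ_; _≤?_; _≟_)
open import Data.Nat.Properties using (≤⇒≤ᵇ; ≤ᵇ⇒≤; ≡ᵇ⇒≡; ≡⇒≡ᵇ; ≤-trans; ≤-refl; ≤-reflexive; n≤1+n; m≤n⇒m<n∨m≡n; ≤-pred; ≰⇒>; ≤-antisym; 1+n≰n; n≤0⇒n≡0)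
open import Data.Product using (Σ; _×_; _,_; proj₁; proj₂)
open import Data.Sum using (_⊎_; inj₁; inj₂)
open import Data.Unit using (tt)
open import Data.Vec using (tabulate; lookup)
open import Data.Vec.Properties using (lookup∘tabulate; lookup⇒[]=; []=⇒lookup; lookup-zipWith)
open import Function using (_∘_)
open import Function.Bundles using (_⇔_; mk⇔; Equivalence)
open import Relation.Binary.Bundles using (Preorder)
import Relation.Binary.Reasoning.Preorder
open import Relation.Binary.PropositionalEquality using (_≡_; refl; sym; trans; cong; cong₂; subst; isEquivalence; module ≡-Reasoning)
open import Relation.Nullary using (¬_; yes; no; does)
open import Relation.Unary using (Decidable)

open Equivalence using (to; from)

sublists : ∀ {X : Set} → List X → List (List X)
sublists []       = [] ∷ []
sublists (x ∷ xs) = map (x ∷_) (sublists xs) ++ sublists xs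

filter∈sublists : ∀ {X : Set} {P : X → Set} (P? : Decidable P) xs → filter P? xs ∈ˡ sublists xs
filter∈sublists P? []       = here refl
filter∈sublists P? (x ∷ xs) with does (P? x)
... | true  = ∈-++⁺ˡ (∈-map⁺ (x ∷_) (filter∈sublists P? xs))
... | false = ∈-++⁺ʳ (map (x ∷_) (sublists xs)) (filter∈sublists P? xs)

∈-sublists⇒⊆ : ∀ {X : Set} (xs : List X) {ys} → ys ∈ˡ sublists xs → ys ⊆ˡ xs
∈-sublists⇒⊆ []       (here refl) ()
∈-sublists⇒⊆ (x ∷ xs) p with ∈-++⁻ (map (x ∷_) (sublists xs)) p
... | inj₂ q = there ∘ ∈-sublists⇒⊆ xs q
... | inj₁ q with ∈-map⁻ (x ∷_) q
... | _ , q′ , refl = ∈-∷⁺ʳ (here refl) (there ∘ ∈-sublists⇒⊆ xs q′)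

if-elim : ∀ {X : Set} (P : X → Set) b {x y} → (T b → P x) → (¬ T b → P y) → P (if b then x else y)
if-elim P true  p q = p tt
if-elim P false p q = q λ ()

∈-tabulate⁺ : ∀ {n} {f : Fin n → Bool} {i} → T (f i) → i ∈ tabulate f
∈-tabulate⁺ {f = f} {i} fi = lookup⇒[]= i (tabulate f) (trans (lookup∘tabulate f i) (to T-≡ fi))

∈-tabulate⁻ : ∀ {n} {f : Fin n → Bool} {i} → i ∈ tabulate f → T (f i)
∈-tabulate⁻ {f = f} {i} p = from T-≡ (trans (sym (lookup∘tabulate f i)) ([]=⇒lookup p))

∪-least : ∀ {n} {p q r : Subset n} → p ⊆ r → q ⊆ r → p ∪ q ⊆ r
∪-least {p = p} {q} p⊆r q⊆r x∈ with x∈p∪q⁻ p q x∈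
... | inj₁ x∈p = p⊆r x∈p
... | inj₂ x∈q = q⊆r x∈q

module Completeness (n : ℕ) (ρ : Fin n → ℕ) where
  open Model n ρ

  variable
    k j : ℕ
    A B : Ty
    q i : Fin n

  ∈Q≤⁺ : ρ i ≤ k → i ∈ Q≤ k
  ∈Q≤⁺ le = ∈-tabulate⁺ (≤⇒≤ᵇ le)

  ∈Q≤⁻ : i ∈ Q≤ k → ρ i ≤ k
  ∈Q≤⁻ p = ≤ᵇ⇒≤ _ _ (∈-tabulate⁻ p)

  ∈Q=⁺ : ρ i ≡ k → i ∈ Q= k
  ∈Q=⁺ e = ∈-tabulate⁺ (≡⇒≡ᵇ _ _ e)

  ∈Q=⁻ : i ∈ Q= k → ρ i ≡ k
  ∈Q=⁻ p = ≡ᵇ⇒≡ _ _ (∈-tabulate⁻ p)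

  ∈sing⇒≡ : i ∈ sing k q → i ≡ q
  ∈sing⇒≡ {k = k} {q} = x∈⁅y⁆⇒x≡y q ∘ if-elim (λ s → s ⊆ ⁅ q ⁆) (ρ q ≤ᵇ k) (λ _ p → p) (λ _ p → ⊥-elim (∉⊥ p))

  ∈sing⁺ : ρ q ≤ k → q ∈ sing k q
  ∈sing⁺ {q} {k} le = if-elim (q ∈_) (ρ q ≤ᵇ k) (λ _ → x∈⁅x⁆ q) (λ ¬le → ⊥-elim (¬le (≤⇒≤ᵇ le)))

  sing⊆ : {P : Subset n} → q ∈ P → sing k q ⊆ P
  sing⊆ {q} {P = P} q∈P i∈ = subst (_∈ P) (sym (∈sing⇒≡ i∈)) q∈P

  sing-empty : ¬ ρ q ≤ k → sing k q ⊆ ∅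
  sing-empty {q} {k} ¬le = if-elim (_⊆ ∅) (ρ q ≤ᵇ k) (λ le → ⊥-elim (¬le (≤ᵇ⇒≤ _ _ le))) (λ _ p → p)

  -- The order on the models

  Le-refl : ∀ A {x} → Le k A x x
  Le-refl o       = λ p → p
  Le-refl (A ⇒ B) = λ _ _ → Le-refl B

  Le-reflexive : ∀ A {x y} → x ≡ y → Le k A x y
  Le-reflexive A refl = Le-refl A

  Le-trans : ∀ A {x y z} → Le k A x y → Le k A y z → Le k A x z
  Le-trans o       x≤y y≤z = y≤z ∘ x≤y
  Le-trans (A ⇒ B) x≤y y≤z = λ h dh → Le-trans B (x≤y h dh) (y≤z h dh)

  Le-preorder : ℕ → Ty → Preorder _ _ _
  Le-preorder k A = record
    { Carrier = Raw A ; _≈_ = _≡_ ; _≲_ = Le k A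
    ; isPreorder = record { isEquivalence = isEquivalence ; reflexive = Le-reflexive A ; trans = Le-trans A } }

  module Le-Reasoning (k : ℕ) (A : Ty) = Relation.Binary.Reasoning.Preorder (Le-preorder k A)

  bot-least : ∀ A {x} → Le k A (bot A) x
  bot-least o       = λ p → ⊥-elim (∉⊥ p)
  bot-least (A ⇒ B) = λ _ _ → bot-least B

  join-upperˡ : ∀ A {x y} → Le k A x (join A x y)
  join-upperˡ o       {y = y} = p⊆p∪q y
  join-upperˡ (A ⇒ B)         = λ _ _ → join-upperˡ B

  join-upperʳ : ∀ A {x y} → Le k A y (join A x y)
  join-upperʳ o       {x} {y} = q⊆p∪q x y
  join-upperʳ (A ⇒ B)         = λ _ _ → join-upperʳ B

  join-least : ∀ A {x y z} → Le k A x z → Le k A y z → Le k A (join A x y) z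
  join-least o       x≤z y≤z = ∪-least x≤z y≤z
  join-least (A ⇒ B) x≤z y≤z = λ h dh → join-least B (x≤z h dh) (y≤z h dh)

  join-mono : ∀ A {x x′ y y′} → Le k A x x′ → Le k A y y′ → Le k A (join A x y) (join A x′ y′)
  join-mono A x≤x′ y≤y′ = join-least A (Le-trans A x≤x′ (join-upperˡ A)) (Le-trans A y≤y′ (join-upperʳ A))

  Eq-refl : ∀ A {x} → Eq k A x x
  Eq-refl A = Le-refl A , Le-refl A

  Eq-reflexive : ∀ A {x y} → x ≡ y → Eq k A x y
  Eq-reflexive A refl = Eq-refl A

  Eq-trans : ∀ A {x y z} → Eq k A x y → Eq k A y z → Eq k A x z
  Eq-trans A (x≤y , y≤x) (y≤z , z≤y) = Le-trans A x≤y y≤z , Le-trans A z≤y y≤x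

  join-cong : ∀ A {x x′ y y′} → Eq k A x x′ → Eq k A y y′ → Eq k A (join A x y) (join A x′ y′)
  join-cong A (x≤ , ≥x) (y≤ , ≥y) = join-mono A x≤ y≤ , join-mono A ≥x ≥y

  over-mono : ∀ A {x y} → Le k A x y → Le k A (over j A x) (over j A y)
  over-mono {j = j} o {x} x≤y p with x∈p∩q⁻ x (Q= j) p
  ... | p∈x , p∈Q = x∈p∩q⁺ (x≤y p∈x , p∈Q)
  over-mono (A ⇒ B) x≤y = λ h dh → over-mono B (x≤y h dh)

  Within : Subset n → ∀ A → Raw A → Set
  Within P o       x = x ⊆ P
  Within P (A ⇒ B) f = ∀ x → Within P B (f x)

  Null : ∀ A → Raw A → Set
  Null = Within ∅

  Within-bot : ∀ {P} A → Within P A (bot A)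
  Within-bot o       = λ p → ⊥-elim (∉⊥ p)
  Within-bot (A ⇒ B) = λ _ → Within-bot B

  Within-join : ∀ {P} A {x y} → Within P A x → Within P A y → Within P A (join A x y)
  Within-join o       x⊆ y⊆ = ∪-least x⊆ y⊆
  Within-join (A ⇒ B) x⊆ y⊆ = λ z → Within-join B (x⊆ z) (y⊆ z)

  Within-Le-over : ∀ A {x y} → Within (Q= k) A x → Le j A x y → Le j A x (over k A y)
  Within-Le-over o       x⊆Q x≤y = λ p → x∈p∩q⁺ (x≤y p , x⊆Q p)
  Within-Le-over (A ⇒ B) x⊆Q x≤y = λ h dh → Within-Le-over B (x⊆Q h) (x≤y h dh)

  ⊆∅⇒⊆ : {x P : Subset n} → x ⊆ ∅ → x ⊆ P
  ⊆∅⇒⊆ x⊆∅ p = ⊥-elim (∉⊥ (x⊆∅ p))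

  Null-least : ∀ A {x y} → Null A x → Le k A x y
  Null-least o       x⊆∅ = ⊆∅⇒⊆ x⊆∅
  Null-least (A ⇒ B) x⊆∅ = λ h _ → Null-least B (x⊆∅ h)

  mutual
    Null-D : ∀ k A {x} → Null A x → D k A x
    Null-D k       o       x⊆∅ = ⊆∅⇒⊆ x⊆∅
    Null-D zero    (A ⇒ B) f∅  = (λ x _ → Null-D zero B (f∅ x)) , (λ x y _ _ _ → Null-least B (f∅ x))
    Null-D (suc k) (A ⇒ B) f∅  = _ , Null-L k (A ⇒ B) f∅ f∅

    Null-L : ∀ k A {x y} → Null A x → Null A y → L k A x y
    Null-L k o x⊆∅ y⊆∅ =
      ⊆∅⇒⊆ x⊆∅ , ⊆∅⇒⊆ y⊆∅ , ⊆-antisym (⊆∅⇒⊆ x⊆∅) (⊆∅⇒⊆ (y⊆∅ ∘ p∩q⊆p _ _))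
    Null-L k (A ⇒ B) f∅ g∅ =
      Null-D k (A ⇒ B) f∅ ,
      ((λ x _ → Null-D (suc k) B (g∅ x)) , (λ x y _ _ _ → Null-least B (g∅ x))) ,
      (λ x₁ x _ → Null-L k B (f∅ x₁) (g∅ x))

  D-bot : ∀ k A → D k A (bot A)
  D-bot k A = Null-D k A (Within-bot A)

  IsMonotone : ℕ → ∀ A B → Raw (A ⇒ B) → Set
  IsMonotone k A B f =
    (∀ x → D k A x → D k B (f x)) ×
    (∀ x y → D k A x → D k A y → Le k A x y → Le k B (f x) (f y))

  D⇒IsMonotone : ∀ k {f} → D k (A ⇒ B) f → IsMonotone k A B f
  D⇒IsMonotone zero    f-mono           = f-mono
  D⇒IsMonotone (suc k) (_ , _ , f-mono , _) = f-mono

  D-app : ∀ k {f x} → D k (A ⇒ B) f → D k A x → D k B (f x)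
  D-app k df dx = proj₁ (D⇒IsMonotone k df) _ dx

  D-mono : ∀ k {f x y} → D k (A ⇒ B) f → D k A x → D k A y → Le k A x y → Le k B (f x) (f y)
  D-mono k df dx dy = proj₂ (D⇒IsMonotone k df) _ _ dx dy

  L⇒D : ∀ A {x₁ x} → L k A x₁ x → D k A x₁
  L⇒D o       = proj₁
  L⇒D (A ⇒ B) = proj₁

  lower : ∀ A {x} → D (suc k) A x → Σ (Raw A) λ x₁ → L k A x₁ x
  lower {k = k} o {x} dx = x ∩ Q≤ k , p∩q⊆q x (Q≤ k) , dx , refl
  lower (A ⇒ B) dx = dx

  mutual
    D-join : ∀ k A {x y} → D k A x → D k A y → D k A (join A x y)
    D-join k       o       dx dy = ∪-least dx dy
    D-join zero    (A ⇒ B) df dg = join-monotone zero df dg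
    D-join (suc k) (A ⇒ B) (_ , lf) (_ , lg) = _ , L-join k (A ⇒ B) lf lg

    join-monotone : ∀ k {f g} → IsMonotone k A B f → IsMonotone k A B g → IsMonotone k A B (join (A ⇒ B) f g)
    join-monotone {B = B} k (fD , f-mono) (gD , g-mono) =
      (λ x dx → D-join k B (fD x dx) (gD x dx)) ,
      (λ x y dx dy x≤y → join-mono B (f-mono x y dx dy x≤y) (g-mono x y dx dy x≤y))

    L-join : ∀ k A {x₁ x y₁ y} → L k A x₁ x → L k A y₁ y → L k A (join A x₁ y₁) (join A x y)
    L-join k o {x = x} {y = y} (dx₁ , dx , refl) (dy₁ , dy , refl) =
      ∪-least dx₁ dy₁ , ∪-least dx dy , sym (∩-distribʳ-∪ (Q≤ k) x y)
    L-join k (A ⇒ B) (df₁ , f-mono , f-L) (dg₁ , g-mono , g-L) =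
      D-join k (A ⇒ B) df₁ dg₁ , join-monotone (suc k) f-mono g-mono ,
      (λ h₁ h l → L-join k B (f-L h₁ h l) (g-L h₁ h l))

  -- Interpretation of intersection types

  variable
    t u : IT A
    U S : List (IT A)

  InT-mono : k ≤ j → InT k t → InT j t
  InT-mono k≤j (l , l≤k , t∈) = l , ≤-trans l≤k k≤j , t∈

  AllInT-mono : k ≤ j → AllInT k U → AllInT j U
  AllInT-mono {U = []}    k≤j _          = tt
  AllInT-mono {U = _ ∷ _} k≤j (t∈ , U∈) = InT-mono k≤j t∈ , AllInT-mono k≤j U∈

  AllInT⁺ : (∀ {t} → t ∈ˡ U → InT k t) → AllInT k U
  AllInT⁺ {U = []}    U∈ = tt
  AllInT⁺ {U = _ ∷ _} U∈ = U∈ (here refl) , AllInT⁺ (U∈ ∘ there)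

  AllInTau⁺ : (∀ {t} → t ∈ˡ U → InTau k t) → AllInTau k U
  AllInTau⁺ {U = []}    U∈ = tt
  AllInTau⁺ {U = _ ∷ _} U∈ = U∈ (here refl) , AllInTau⁺ (U∈ ∘ there)

  InTau⇒InT : InTau k t → InT k t
  InTau⇒InT {k} t∈ = k , ≤-refl , t∈

  arr-args : InT k (arr U u) → AllInT k U
  arr-args (_ , l≤k , U∈ , _) = AllInT-mono l≤k U∈

  arr-result : InT k (arr U u) → InT k u
  arr-result (l , l≤k , _ , u∈) = l , l≤k , u∈

  base-rank : InT k (base q) → ρ q ≤ k
  base-rank {k} (_ , l≤k , refl) = l≤k

  -- below? k t h decides ⟦t⟧ᵏ ≤ h only for monotone h, i.e. for h ∈ Dᵏ.
  mutual
    below? : ℕ → IT A → Raw A → Bool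
    below? k (base q)  h = lookup h q
    below? k (arr U u) h = below? k u (h (interps k U))

    allBelow? : ℕ → List (IT A) → Raw A → Bool
    allBelow? k []      h = true
    allBelow? k (t ∷ U) h = below? k t h ∧ allBelow? k U h

    interp : ℕ → IT A → Raw A
    interp k (base q)            = sing k q
    interp k (arr {B = B} U u) h = if allBelow? k U h then interp k u else bot B

    interps : ℕ → List (IT A) → Raw A
    interps {A} k []      = bot A
    interps {A} k (t ∷ U) = join A (interp k t) (interps k U)

  interp-arr-above : ∀ {k A B} (U : List (IT A)) (u : IT B) {h} → T (allBelow? k U h) →
                     interp k (arr U u) h ≡ interp k u
  interp-arr-above {k} U u {h} U≤h with allBelow? k U h
  ... | true = refl

  interp-arr-below : ∀ {k A B} (U : List (IT A)) (u : IT B) {h} → ¬ T (allBelow? k U h) →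
                     interp k (arr U u) h ≡ bot B
  interp-arr-below {k} U u {h} U≰h with allBelow? k U h
  ... | true  = ⊥-elim (U≰h tt)
  ... | false = refl

  interps-upper : {U : List (IT A)} → t ∈ˡ U → Le k A (interp k t) (interps k U)
  interps-upper {A} (here refl) = join-upperˡ A
  interps-upper {A} (there p)   = Le-trans A (interps-upper p) (join-upperʳ A)

  interps-least : {U : List (IT A)} {z : Raw A} → (∀ {t} → t ∈ˡ U → Le k A (interp k t) z) → Le k A (interps k U) z
  interps-least {A} {U = []}    U≤z = bot-least A
  interps-least {A} {U = _ ∷ _} U≤z = join-least A (U≤z (here refl)) (interps-least (U≤z ∘ there))

  interps-++ : (U S : List (IT A)) → Eq k A (join A (interps k U) (interps k S)) (interps k (U ++ S))
  interps-++ {A} U S =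
    join-least A (interps-least {U = U} (interps-upper ∘ ∈-++⁺ˡ)) (interps-least {U = S} (interps-upper ∘ ∈-++⁺ʳ U)) ,
    interps-least λ p → case-++ (∈-++⁻ U p)
    where
    case-++ : ∀ {t} → t ∈ˡ U ⊎ t ∈ˡ S → Le _ A (interp _ t) (join A (interps _ U) (interps _ S))
    case-++ (inj₁ p) = Le-trans A (interps-upper p) (join-upperˡ A)
    case-++ (inj₂ p) = Le-trans A (interps-upper p) (join-upperʳ A)

  lookup⇔sing⊆ : ρ q ≤ k → ∀ h → T (lookup h q) ⇔ sing k q ⊆ h
  lookup⇔sing⊆ {q} le h = mk⇔
    (λ q∈h {i} → sing⊆ (lookup⇒[]= q h (to T-≡ q∈h)) {i})
    (λ sing⊆h → from T-≡ ([]=⇒lookup (sing⊆h (∈sing⁺ le))))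

  lookup-∩Q≤ : ρ q ≤ k → ∀ g → lookup (g ∩ Q≤ k) q ≡ lookup g q
  lookup-∩Q≤ {q} {k} le g = begin
    lookup (g ∩ Q≤ k) q          ≡⟨ lookup-zipWith _∧_ q g (Q≤ k) ⟩
    lookup g q ∧ lookup (Q≤ k) q ≡⟨ cong (lookup g q ∧_) ([]=⇒lookup (∈Q≤⁺ le)) ⟩
    lookup g q ∧ true            ≡⟨ ∧-identityʳ _ ⟩
    lookup g q                   ∎
    where open ≡-Reasoning

  sing-L : ρ q ≤ k → L k o (sing k q) (sing (suc k) q)
  sing-L {q} {k} le =
    sing⊆ (∈Q≤⁺ le) , sing⊆ (∈Q≤⁺ le′) ,
    ⊆-antisym (sing⊆ (x∈p∩q⁺ (∈sing⁺ le′ , ∈Q≤⁺ le))) (sing⊆ (∈sing⁺ le) ∘ p∩q⊆p _ _)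
    where
    le′ : ρ q ≤ suc k
    le′ = ≤-trans le (n≤1+n k)

  sing-L-top : ρ q ≡ suc k → ∀ {x} → Null o x → L k o x (sing (suc k) q)
  sing-L-top {q} {k} e x⊆∅ =
    ⊆∅⇒⊆ x⊆∅ , sing⊆ (∈Q≤⁺ (≤-reflexive e)) , ⊆-antisym (⊆∅⇒⊆ x⊆∅) above-k
    where
    above-k : sing (suc k) q ∩ Q≤ k ⊆ _
    above-k p with x∈p∩q⁻ _ (Q≤ k) p
    ... | p∈sing , p∈Q = ⊥-elim (1+n≰n (subst (_≤ k) (trans (cong ρ (∈sing⇒≡ p∈sing)) e) (∈Q≤⁻ p∈Q)))

  interp-null : ∀ {k A} {t : IT A} → InTau (suc k) t → Null A (interp k t)
  interp-null {k} {t = base q} e = sing-empty λ le → 1+n≰n (subst (_≤ k) e le)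
  interp-null {k} {_ ⇒ B} {arr U u} (_ , u∈) x =
    if-elim (Null B) (allBelow? k U x) (λ _ → interp-null u∈) (λ _ → Within-bot B)

  L-if : ∀ A {b₁ b₂ x₁ x₂ y₁ y₂} → b₁ ≡ b₂ → L k A x₁ x₂ → L k A y₁ y₂ →
         L k A (if b₁ then x₁ else y₁) (if b₂ then x₂ else y₂)
  L-if A {true}  refl lx _  = lx
  L-if A {false} refl _  ly = ly

  -- One simultaneous induction: monotonicity of ⟦U → u⟧ needs correctness of below? on U, which
  -- needs ⟦U⟧ ∈ Dᵏ, and at level k+1 membership is witnessed by the relation to level k.
  mutual
    interp-D : ∀ k {A} {t : IT A} → InT k t → D k A (interp k t)
    interp-D k       {t = base q}  t∈ = sing⊆ (∈Q≤⁺ (base-rank t∈))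
    interp-D zero    {t = arr U u} t∈ = interp-arr-monotone zero (arr-args t∈) (arr-result t∈)
    interp-D (suc k) {t = arr U u} t∈ = _ , interp-L k t∈

    interps-D : ∀ k {A} {U : List (IT A)} → AllInT k U → D k A (interps k U)
    interps-D k {A} {[]}    _         = D-bot k A
    interps-D k {A} {_ ∷ _} (t∈ , U∈) = D-join k A (interp-D k t∈) (interps-D k U∈)

    interp-arr-monotone : ∀ k {A B} {U : List (IT A)} {u : IT B} → AllInT k U → InT k u →
                          IsMonotone k A B (interp k (arr U u))
    interp-arr-monotone k {A} {B} {U} {u} U∈ u∈ = preserves , monotone
      where
      preserves : ∀ x → D k A x → D k B (interp k (arr U u) x)
      preserves x _ = if-elim (D k B) (allBelow? k U x) (λ _ → interp-D k u∈) (λ _ → D-bot k B)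

      monotone : ∀ x y → D k A x → D k A y → Le k A x y →
                 Le k B (interp k (arr U u) x) (interp k (arr U u) y)
      monotone x y dx dy x≤y = if-elim (λ w → Le k B w (interp k (arr U u) y)) (allBelow? k U x)
        (λ U≤x → Le-reflexive B (sym (interp-arr-above U u
                   (from (allBelow?-correct k U∈ dy) (Le-trans A (to (allBelow?-correct k U∈ dx) U≤x) x≤y)))))
        (λ _ → bot-least B)

    below?-correct : ∀ k {A} {t : IT A} → InT k t → ∀ {h} → D k A h →
                     T (below? k t h) ⇔ Le k A (interp k t) h
    below?-correct k {t = base q} t∈ {h} _ = lookup⇔sing⊆ (base-rank t∈) h
    below?-correct k {A ⇒ B} {arr U u} t∈ {h} dh = mk⇔ below⇒≤ ≤⇒below
      where
      U∈ : AllInT k U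
      U∈ = arr-args t∈

      dU : D k A (interps k U)
      dU = interps-D k U∈

      u-correct : T (below? k u (h (interps k U))) ⇔ Le k B (interp k u) (h (interps k U))
      u-correct = below?-correct k (arr-result t∈) (D-app k dh dU)

      below⇒≤ : T (below? k u (h (interps k U))) → Le k (A ⇒ B) (interp k (arr U u)) h
      below⇒≤ u≤ x dx = if-elim (λ w → Le k B w (h x)) (allBelow? k U x)
        (λ U≤x → Le-trans B (to u-correct u≤) (D-mono k dh dU dx (to (allBelow?-correct k U∈ dx) U≤x)))
        (λ _ → bot-least B)

      ≤⇒below : Le k (A ⇒ B) (interp k (arr U u)) h → T (below? k u (h (interps k U)))
      ≤⇒below le = from u-correct (subst (λ w → Le k B w (h (interps k U)))
        (interp-arr-above U u (from (allBelow?-correct k U∈ dU) (Le-refl A))) (le (interps k U) dU))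

    allBelow?-correct : ∀ k {A} {U : List (IT A)} → AllInT k U → ∀ {h} → D k A h →
                        T (allBelow? k U h) ⇔ Le k A (interps k U) h
    allBelow?-correct k {A} {[]}    _         _  = mk⇔ (λ _ → bot-least A) (λ _ → tt)
    allBelow?-correct k {A} {_ ∷ _} (t∈ , U∈) dh = mk⇔
      (λ tU≤ → join-least A (to (below?-correct k t∈ dh) (proj₁ (to T-∧ tU≤)))
                            (to (allBelow?-correct k U∈ dh) (proj₂ (to T-∧ tU≤))))
      (λ tU≤ → from T-∧ (from (below?-correct k t∈ dh) (Le-trans A (join-upperˡ A) tU≤) ,
                         from (allBelow?-correct k U∈ dh) (Le-trans A (join-upperʳ A) tU≤)))

    interp-L : ∀ k {A} {t : IT A} → InT (suc k) t → L k A (interp k t) (interp (suc k) t)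
    interp-L k (l , l≤ , t∈) with m≤n⇒m<n∨m≡n l≤
    ... | inj₁ l<   = interp-L-lower k (l , ≤-pred l< , t∈)
    ... | inj₂ refl = interp-L-top k t∈ (interp-null t∈)

    interps-L : ∀ k {A} {U : List (IT A)} → AllInT (suc k) U → L k A (interps k U) (interps (suc k) U)
    interps-L k {A} {[]}    _         = Null-L k A (Within-bot A) (Within-bot A)
    interps-L k {A} {_ ∷ _} (t∈ , U∈) = L-join k A (interp-L k t∈) (interps-L k U∈)

    interp-L-lower : ∀ k {A} {t : IT A} → InT k t → L k A (interp k t) (interp (suc k) t)
    interp-L-lower k {t = base q} t∈ = sing-L (base-rank t∈)
    interp-L-lower k {A ⇒ B} {arr U u} t∈ =
      interp-D k t∈ ,
      interp-arr-monotone (suc k) (AllInT-mono (n≤1+n k) (arr-args t∈)) (InT-mono (n≤1+n k) (arr-result t∈)) ,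
      λ _ _ lg → L-if B (allBelow?-L k (arr-args t∈) lg) (interp-L-lower k (arr-result t∈))
                        (Null-L k B (Within-bot B) (Within-bot B))

    interp-L-top : ∀ k {A} {t : IT A} → InTau (suc k) t → ∀ {x} → Null A x → L k A x (interp (suc k) t)
    interp-L-top k {t = base q} e x∅ = sing-L-top e x∅
    interp-L-top k {A ⇒ B} {arr U u} (U∈ , u∈) {x} x∅ =
      Null-D k (A ⇒ B) x∅ ,
      interp-arr-monotone (suc k) U∈ (InTau⇒InT u∈) ,
      λ g₁ g₂ _ → if-elim (L k B (x g₁)) (allBelow? (suc k) U g₂)
                    (λ _ → interp-L-top k u∈ (x∅ g₁)) (λ _ → Null-L k B (x∅ g₁) (Within-bot B))

    below?-L : ∀ k {A} {t : IT A} → InT k t → ∀ {g₁ g₂} → L k A g₁ g₂ → below? k t g₁ ≡ below? (suc k) t g₂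
    below?-L k {t = base q}  t∈ {g₂ = g₂} (_ , _ , refl) = lookup-∩Q≤ (base-rank t∈) g₂
    below?-L k {t = arr U u} t∈ (_ , _ , g-L)  =
      below?-L k (arr-result t∈) (g-L _ _ (interps-L k (AllInT-mono (n≤1+n k) (arr-args t∈))))

    allBelow?-L : ∀ k {A} {U : List (IT A)} → AllInT k U → ∀ {g₁ g₂} → L k A g₁ g₂ →
                  allBelow? k U g₁ ≡ allBelow? (suc k) U g₂
    allBelow?-L k {U = []}    _         _  = refl
    allBelow?-L k {U = _ ∷ _} (t∈ , U∈) lg = cong₂ _∧_ (below?-L k t∈ lg) (allBelow?-L k U∈ lg)

  -- Enumerating the types of each rank

  mutual
    enumτ : ℕ → ∀ A → List (IT A)
    enumτ l o       = map base (filter (λ q → ρ q ≟ l) (allFin n))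
    enumτ l (A ⇒ B) = concatMap (λ U → map (arr U) (enumτ l B)) (sublists (enum𝒯 l A))

    enum𝒯 : ℕ → ∀ A → List (IT A)
    enum𝒯 zero    A = enumτ zero A
    enum𝒯 (suc l) A = enum𝒯 l A ++ enumτ (suc l) A

  mutual
    enumτ-sound : ∀ l A {t} → t ∈ˡ enumτ l A → InTau l t
    enumτ-sound l o p with ∈-map⁻ base p
    ... | q , q∈ , refl = proj₂ (∈-filter⁻ (λ q → ρ q ≟ l) {xs = allFin n} q∈)
    enumτ-sound l (A ⇒ B) p with find (∈-concatMap⁻ (λ U → map (arr U) (enumτ l B)) {xs = sublists (enum𝒯 l A)} p)
    ... | U , U∈ , p′ with ∈-map⁻ (arr U) p′
    ... | u , u∈ , refl =
      AllInT⁺ (enum𝒯-sound l A ∘ ∈-sublists⇒⊆ (enum𝒯 l A) U∈) , enumτ-sound l B u∈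

    enum𝒯-sound : ∀ k A {t} → t ∈ˡ enum𝒯 k A → InT k t
    enum𝒯-sound zero    A p = InTau⇒InT (enumτ-sound zero A p)
    enum𝒯-sound (suc k) A p with ∈-++⁻ (enum𝒯 k A) p
    ... | inj₁ p′ = InT-mono (n≤1+n k) (enum𝒯-sound k A p′)
    ... | inj₂ p′ = InTau⇒InT (enumτ-sound (suc k) A p′)

  base∈enumτ : ρ q ≡ k → base q ∈ˡ enumτ k o
  base∈enumτ {q} {k} e = ∈-map⁺ base (∈-filter⁺ (λ q → ρ q ≟ k) (∈-allFin q) e)

  arr∈enumτ : ∀ {k A B} {U : List (IT A)} {u : IT B} →
              U ∈ˡ sublists (enum𝒯 k A) → u ∈ˡ enumτ k B → arr U u ∈ˡ enumτ k (A ⇒ B)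
  arr∈enumτ {k} {A} {B} {U} U∈ u∈ =
    ∈-concatMap⁺ (λ U → map (arr U) (enumτ k B)) (lose U∈ (∈-map⁺ (arr U) u∈))

  interp-exact : ∀ {k A} {t : IT A} → InTau k t → Within (Q= k) A (interp k t)
  interp-exact {t = base q} e = sing⊆ (∈Q=⁺ e)
  interp-exact {k} {_ ⇒ B} {arr U u} (_ , u∈) x =
    if-elim (Within (Q= k) B) (allBelow? k U x) (λ _ → interp-exact u∈) (λ _ → Within-bot B)

  canonical : ℕ → ∀ A → Raw A → List (IT A)
  canonical k A d = filterᵇ (λ t → below? k t d) (enumτ k A)

  canonical-sound : ∀ {k A d t} → t ∈ˡ canonical k A d → t ∈ˡ enumτ k A × T (below? k t d)
  canonical-sound = ∈-filter⁻ (T? ∘ _)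

  canonical-≤-over : ∀ k A {d} → D k A d → Le k A (interps k (canonical k A d)) (over k A d)
  canonical-≤-over k A dd = interps-least λ p →
    let t∈ = enumτ-sound k A (proj₁ (canonical-sound p)) in
    Within-Le-over A (interp-exact t∈) (to (below?-correct k (InTau⇒InT t∈) dd) (proj₂ (canonical-sound p)))

  interp-within : ∀ {k j A} {t : IT A} → InT k t → Within (Q≤ k) A (interp j t)
  interp-within {t = base q} t∈ = sing⊆ (∈Q≤⁺ (base-rank t∈))
  interp-within {j = j} {_ ⇒ B} {arr U u} t∈ x =
    if-elim (Within _ B) (allBelow? j U x) (λ _ → interp-within (arr-result t∈)) (λ _ → Within-bot B)

  interps-within : ∀ {k j A} {U : List (IT A)} → AllInT k U → Within (Q≤ k) A (interps j U)
  interps-within {A = A} {[]}    _         = Within-bot A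
  interps-within {A = A} {_ ∷ _} (t∈ , U∈) = Within-join A (interp-within t∈) (interps-within U∈)

  -- Completeness

  over-zero : ∀ A {x} → D zero A x → Eq zero A x (over zero A x)
  over-zero o       {x} dx = (λ p → x∈p∩q⁺ (p , ∈Q=⁺ (n≤0⇒n≡0 (∈Q≤⁻ (dx p))))) , p∩q⊆p x _
  over-zero (A ⇒ B)     df =
    (λ x dx → proj₁ (over-zero B (D-app zero df dx))) , (λ x dx → proj₂ (over-zero B (D-app zero df dx)))

  -- Below rank k an element of Dᵏ⁺¹ is determined by its partner in Dᵏ; what is left has rank exactly k+1.
  L-decompose : ∀ k A {x₁ x y₁ y} → L k A x₁ x → L k A y₁ y → Eq k A x₁ y₁ → Within (Q≤ k) A y →
                Eq (suc k) A x (join A y (over (suc k) A x))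
  L-decompose k o {x = x} {y = y} (_ , dx , refl) (_ , _ , refl) (x₁≤y₁ , y₁≤x₁) y⊆Q =
    x⊆ , ∪-least y⊆x (p∩q⊆p x _)
    where
    x⊆ : x ⊆ y ∪ (x ∩ Q= (suc k))
    x⊆ {i} p with ρ i ≤? k
    ... | yes le = x∈p∪q⁺ (inj₁ (p∩q⊆p y (Q≤ k) (x₁≤y₁ (x∈p∩q⁺ (p , ∈Q≤⁺ le)))))
    ... | no ¬le = x∈p∪q⁺ (inj₂ (x∈p∩q⁺ (p , ∈Q=⁺ (≤-antisym (∈Q≤⁻ (dx p)) (≰⇒> ¬le)))))

    y⊆x : y ⊆ x
    y⊆x p = p∩q⊆p x (Q≤ k) (y₁≤x₁ (x∈p∩q⁺ (p , y⊆Q p)))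
  L-decompose k (A ⇒ B) {x = x} {y = y} (_ , _ , x-L) (_ , _ , y-L) (x₁≤y₁ , y₁≤x₁) y⊆Q =
    (λ z dz → proj₁ (at dz)) , (λ z dz → proj₂ (at dz))
    where
    at : ∀ {z} → D (suc k) A z → Eq (suc k) B (x z) (join B (y z) (over (suc k) B (x z)))
    at {z} dz with lower A dz
    ... | z₁ , lz = L-decompose k B (x-L z₁ z lz) (y-L z₁ z lz)
                      (x₁≤y₁ z₁ (L⇒D A lz) , y₁≤x₁ z₁ (L⇒D A lz)) (y⊆Q z)

  Represented : ℕ → ∀ A → Raw A → Set
  Represented k A d = Σ (List (IT A)) λ S → S ⊆ˡ enum𝒯 k A × Eq k A d (interps k S)

  sublist-representative : ∀ k A {h} → D k A h → Represented k A h →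
                           Σ (List (IT A)) λ U → U ∈ˡ sublists (enum𝒯 k A) × Eq k A h (interps k U)
  sublist-representative k A {h} dh (S , S⊆ , h≈S) =
    Uₕ , filter∈sublists (T? ∘ below-h) (enum𝒯 k A) , Le-trans A (proj₁ h≈S) S≤U , U≤h
    where
    below-h : IT A → Bool
    below-h t = below? k t h

    Uₕ : List (IT A)
    Uₕ = filterᵇ below-h (enum𝒯 k A)

    below-h-correct : ∀ {t} → t ∈ˡ enum𝒯 k A → T (below-h t) ⇔ Le k A (interp k t) h
    below-h-correct t∈ = below?-correct k (enum𝒯-sound k A t∈) dh

    S≤U : Le k A (interps k S) (interps k Uₕ)
    S≤U = interps-least λ t∈S → interps-upper (∈-filter⁺ (T? ∘ below-h) (S⊆ t∈S)
      (from (below-h-correct (S⊆ t∈S)) (Le-trans A (interps-upper t∈S) (proj₂ h≈S))))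

    U≤h : Le k A (interps k Uₕ) h
    U≤h = interps-least λ t∈U →
      let t∈ , t≤h = ∈-filter⁻ (T? ∘ below-h) {xs = enum𝒯 k A} t∈U in to (below-h-correct t∈) t≤h

  mutual
    represent : ∀ k A {d} → D k A d → Represented k A d
    represent zero A dd =
      canonical zero A _ , proj₁ ∘ canonical-sound , Eq-trans A (over-zero A dd) (over-≈-canonical zero A dd)
    represent (suc k) A {d} dd with lower A dd
    ... | d₁ , ld with represent k A (L⇒D A ld)
    ... | S₁ , S₁⊆ , d₁≈S₁ = S₁ ++ C , ++⁺ S₁⊆ (proj₁ ∘ canonical-sound) , d≈
      where
      C : List (IT A)
      C = canonical (suc k) A d

      S₁∈ : AllInT k S₁
      S₁∈ = AllInT⁺ (enum𝒯-sound k A ∘ S₁⊆)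

      d≈ : Eq (suc k) A d (interps (suc k) (S₁ ++ C))
      d≈ = Eq-trans A (L-decompose k A ld (interps-L k (AllInT-mono (n≤1+n k) S₁∈)) d₁≈S₁ (interps-within S₁∈))
          (Eq-trans A (join-cong A (Eq-refl A) (over-≈-canonical (suc k) A dd)) (interps-++ S₁ C))

    over-≈-canonical : ∀ k A {d} → D k A d → Eq k A (over k A d) (interps k (canonical k A d))
    over-≈-canonical k A dd = over-≤-canonical k A dd , canonical-≤-over k A dd

    over-≤-canonical : ∀ k A {d} → D k A d → Le k A (over k A d) (interps k (canonical k A d))
    over-≤-canonical k o {d} dd {q} p with x∈p∩q⁻ d (Q= k) p
    ... | q∈d , q∈Q = interps-upper
      (∈-filter⁺ (T? ∘ λ t → below? k t d) (base∈enumτ (∈Q=⁻ q∈Q)) (from T-≡ ([]=⇒lookup q∈d)))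
      (∈sing⁺ (≤-reflexive (∈Q=⁻ q∈Q)))
    over-≤-canonical k (A ⇒ B) {d} dd h dh with sublist-representative k A dh (represent k A dh)
    ... | U , U∈ , h≈U = begin
      over k B (d h)                              ≲⟨ over-mono B (D-mono k dd dh dU (proj₁ h≈U)) ⟩
      over k B (d (interps k U))                  ≲⟨ over-≤-canonical k B (D-app k dd dU) ⟩
      interps k (canonical k B (d (interps k U))) ≲⟨ interps-least step-below ⟩
      interps k (canonical k (A ⇒ B) d) h         ∎
      where
      open Le-Reasoning k B

      U-args : AllInT k U
      U-args = AllInT⁺ (enum𝒯-sound k A ∘ ∈-sublists⇒⊆ (enum𝒯 k A) U∈)

      dU : D k A (interps k U)
      dU = interps-D k U-args

      -- u ∈ τᵏ below d ⟦U⟧ gives the step type U → u below d, and its value at h ≈ ⟦U⟧ is ⟦u⟧.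
      step-below : ∀ {u} → u ∈ˡ canonical k B (d (interps k U)) →
                   Le k B (interp k u) (interps k (canonical k (A ⇒ B) d) h)
      step-below {u} u∈ = subst (λ w → Le k B w (interps k (canonical k (A ⇒ B) d) h))
        (interp-arr-above U u (from (allBelow?-correct k U-args dh) (proj₂ h≈U)))
        (interps-upper (∈-filter⁺ (T? ∘ λ t → below? k t d) (arr∈enumτ U∈ (proj₁ (canonical-sound u∈)))
                          (proj₂ (canonical-sound u∈))) h dh)

  mutual
    interp-Den : ∀ k {A} {t : IT A} → InT k t → Den k t (interp k t)
    interp-Den k {t = base q}            _  = Eq-refl {k} o
    interp-Den k {A ⇒ B} {t = arr U u} t∈ =
      interps k U , interp k u , interps-DenS k (arr-args t∈) (Eq-refl A) , interp-Den k (arr-result t∈) , is-step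
      where
      is-step : Step k A B (interps k U) (interp k u) (interp k (arr U u))
      is-step h dh =
        (λ U≤h → Eq-reflexive B (interp-arr-above U u (from (allBelow?-correct k (arr-args t∈) dh) U≤h))) ,
        (λ U≰h → Eq-reflexive B (interp-arr-below U u (U≰h ∘ to (allBelow?-correct k (arr-args t∈) dh))))

    interps-DenS : ∀ k {A} {S : List (IT A)} {d} → AllInT k S → Eq k A d (interps k S) → DenS k S d
    interps-DenS k {S = []}        _         d≈ = d≈
    interps-DenS k {A} {S = _ ∷ _} (t∈ , S∈) d≈ =
      _ , _ , interp-Den k t∈ , interps-DenS k S∈ (Eq-refl A) , d≈

  completeness : ∀ k A {d} → D k A d →
                 (Σ (List (IT A)) λ S → AllInT k S × DenS k S d) ×
                 (Σ (List (IT A)) λ S′ → AllInTau k S′ × DenS k S′ (over k A d))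
  completeness k A dd with represent k A dd
  ... | S , S⊆ , d≈S =
    (S , S∈ , interps-DenS k S∈ d≈S) ,
    (canonical k A _ , AllInTau⁺ C∈ , interps-DenS k (AllInT⁺ (InTau⇒InT ∘ C∈)) (over-≈-canonical k A dd))
    where
    S∈ : AllInT k S
    S∈ = AllInT⁺ (enum𝒯-sound k A ∘ S⊆)

    C∈ : ∀ {t} → t ∈ˡ canonical k A _ → InTau k t
    C∈ = enumτ-sound k A ∘ proj₁ ∘ canonical-sound

lemma5p2 : (n : ℕ) (ρ : Fin n → ℕ) (m : ℕ) →
           (∀ q → ρ q ≤ m) → Σ (Fin n) (λ q → ρ q ≡ m) →
           (k : ℕ) → k ≤ m → (A : Ty) (d : Model.Raw n ρ A) → Model.D n ρ k A d →
           (Σ (List (Model.IT n ρ A)) λ S →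
               Model.AllInT n ρ k S × Model.DenS n ρ k S d)
           × (Σ (List (Model.IT n ρ A)) λ S′ →
               Model.AllInTau n ρ k S′ × Model.DenS n ρ k S′ (Model.over n ρ k A d))
lemma5p2 n ρ _ _ _ k _ A _ dd = Completeness.completeness n ρ k A dd
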